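{- Let $V$ be an $\mathbb{R}$-linear space, let $\beta\colon V\times V\to\mathbb{R}$ be a bilinear form with $\beta(x,y)=\beta(y,x)$ for all $x,y\in V$, and let $v_{01},v_{10},h_a\in V$ be nonzero vectors such that: - $\beta(v_{01},v_{01})=0$; - $\beta(v_{10},v_{10})=0$; - $\beta(v_{01},v_{10})=1$; - (Hodge property) for every $x\in V$ with $\beta(x,h_a)=0$ one has $\beta(x,x)\le0$. Then for every $x\in V$, $$\beta(x,x)\le 2\,\beta(x,v_{01})\,\beta(x,v_{10}).$$ -}

module Defs where

open import Level using (Level; 0ℓ; suc; _⊔_)
open import Algebra.Bundles using (CommutativeRing)
open import Algebra.Module.Bundles using (Module)
open import Relation.Binary.Structures using (IsTotalOrder)
open import Relation.Nullary using (¬_)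
open import Data.Product using (Σ; ∃; _×_)

-- The real numbers, axiomatised as a (Dedekind-)complete ordered field.
-- (agda-stdlib has no ℝ; every model of this record is isomorphic to ℝ.)
record RealField : Set₁ where
  field
    commRing : CommutativeRing 0ℓ 0ℓ
  open CommutativeRing commRing public hiding (ring)
  field
    _≤_        : Carrier → Carrier → Set
    isTotalOrder : IsTotalOrder _≈_ _≤_
    0≉1        : ¬ (0# ≈ 1#)
    inverse    : ∀ x → ¬ (x ≈ 0#) → Σ Carrier (λ y → x * y ≈ 1#)
    +-mono-≤   : ∀ x y z → x ≤ y → (x + z) ≤ (y + z)
    *-nonneg   : ∀ x y → 0# ≤ x → 0# ≤ y → 0# ≤ (x * y)
    sup        : (P : Carrier → Set) → ∃ P →
                 ∃ (λ b → ∀ x → P x → x ≤ b) →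
                 ∃ (λ s → (∀ x → P x → x ≤ s) ×
                          (∀ b → (∀ x → P x → x ≤ b) → s ≤ b))

module _ (ℝ : RealField) {m ℓm : Level} (V : Module (RealField.commRing ℝ) m ℓm) where
  open RealField ℝ
  open Module V renaming (Carrierᴹ to Vec)

  -- A symmetric ℝ-bilinear form on V (linearity in the second argument
  -- follows from linearity in the first together with symmetry).
  record IsSymmetricBilinear (β : Vec → Vec → Carrier) : Set (m ⊔ ℓm) where
    field
      β-cong : ∀ {x x′ y y′} → x ≈ᴹ x′ → y ≈ᴹ y′ → β x y ≈ β x′ y′
      β-+ˡ   : ∀ x y z → β (x +ᴹ y) z ≈ (β x z + β y z)
      β-*ˡ   : ∀ (r : Carrier) x z → β (r *ₗ x) z ≈ (r * β x z)
      β-sym  : ∀ x y → β x y ≈ β y x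

{-# OPTIONS --safe #-}
-- The hyperbolic pair v01, v10 spans a plane on which β(x,x) - 2β(x,v01)β(x,v10)
-- changes by a square: translating x by s·v01 + t·v10 with s + β(x,v10) = t + β(x,v01) = l
-- gives β(y,y) + 2β(x,v01)β(x,v10) = β(x,x) + 2l². Since β(v01+v10, v01+v10) = 2 > 0,
-- the Hodge property forces β(v01+v10, ha) ≠ 0, so l can be chosen to make y orthogonal
-- to ha; then β(y,y) ≤ 0 and the claim follows.
module Submission where

open import Defs
open import Level using (Level)
open import Algebra.Module.Bundles using (Module)
open import Algebra.Bundles using (CommutativeRing)
open import Relation.Binary.Bundles using (Poset)
open import Relation.Binary.Structures using (IsTotalOrder)
open import Relation.Nullary using (¬_)
open import Data.Product using (∃; _,_; proj₁; proj₂)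
open import Data.Sum using (inj₁; inj₂)

module OrderedFieldProperties (ℝ : RealField) where
  open RealField ℝ
  open IsTotalOrder isTotalOrder public
    using (total; antisym; ≤-respˡ-≈; ≤-respʳ-≈)
    renaming (trans to ≤-trans)
  open import Algebra.Properties.Ring (CommutativeRing.ring commRing)
    using (-‿distribˡ-*; -‿distribʳ-*)
  open import Algebra.Properties.AbelianGroup +-abelianGroup using (⁻¹-involutive)
  open import Relation.Binary.Reasoning.Setoid setoid

  poset : Poset _ _ _
  poset = record { isPartialOrder = IsTotalOrder.isPartialOrder isTotalOrder }

  two : Carrier
  two = 1# + 1#

  -x*-x≈x*x : ∀ x → - x * - x ≈ x * x
  -x*-x≈x*x x = begin
    - x * - x      ≈⟨ -‿distribˡ-* x (- x) ⟨
    - (x * - x)    ≈⟨ -‿cong (-‿distribʳ-* x x) ⟨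
    - - (x * x)    ≈⟨ ⁻¹-involutive (x * x) ⟩
    x * x          ∎

  x≤0⇒0≤-x : ∀ {x} → x ≤ 0# → 0# ≤ (- x)
  x≤0⇒0≤-x {x} x≤0 = ≤-respˡ-≈ (-‿inverseʳ x) (≤-respʳ-≈ (+-identityˡ (- x)) (+-mono-≤ x 0# (- x) x≤0))

  0≤x*x : ∀ x → 0# ≤ (x * x)
  0≤x*x x with total 0# x
  ... | inj₁ 0≤x = *-nonneg x x 0≤x 0≤x
  ... | inj₂ x≤0 = ≤-respʳ-≈ (-x*-x≈x*x x) (*-nonneg (- x) (- x) (x≤0⇒0≤-x x≤0) (x≤0⇒0≤-x x≤0))

  0≤1 : 0# ≤ 1#
  0≤1 = ≤-respʳ-≈ (*-identityˡ 1#) (0≤x*x 1#)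

  x≤x+y : ∀ {x y} → 0# ≤ y → x ≤ (x + y)
  x≤x+y {x} {y} 0≤y = ≤-respˡ-≈ (+-identityˡ x) (≤-respʳ-≈ (+-comm y x) (+-mono-≤ 0# y x 0≤y))

  1≤2 : 1# ≤ two
  1≤2 = x≤x+y 0≤1

  2≰0 : ¬ (two ≤ 0#)
  2≰0 2≤0 = 0≉1 (antisym 0≤1 (≤-trans 1≤2 2≤0))

  0≤2*x*x : ∀ x → 0# ≤ (two * (x * x))
  0≤2*x*x x = *-nonneg two (x * x) (≤-trans 0≤1 1≤2) (0≤x*x x)

  linear-solvable : ∀ {p} → ¬ (p ≈ 0#) → ∀ q → ∃ λ l → l * p + q ≈ 0#
  linear-solvable {p} p≉0 q with inverse p p≉0
  ... | p⁻¹ , pp⁻¹≈1 = - (q * p⁻¹) , (begin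
    - (q * p⁻¹) * p + q    ≈⟨ +-congʳ (-‿distribˡ-* (q * p⁻¹) p) ⟨
    - (q * p⁻¹ * p) + q    ≈⟨ +-congʳ (-‿cong (*-assoc q p⁻¹ p)) ⟩
    - (q * (p⁻¹ * p)) + q  ≈⟨ +-congʳ (-‿cong (*-congˡ (trans (*-comm p⁻¹ p) pp⁻¹≈1))) ⟩
    - (q * 1#) + q         ≈⟨ +-congʳ (-‿cong (*-identityʳ q)) ⟩
    - q + q                ≈⟨ -‿inverseˡ q ⟩
    0#                     ∎)

module SymmetricBilinearProperties
  (ℝ : RealField) {m ℓm : Level} (V : Module (RealField.commRing ℝ) m ℓm)
  {β : Module.Carrierᴹ V → Module.Carrierᴹ V → RealField.Carrier ℝ}
  (isSymmetricBilinear : IsSymmetricBilinear ℝ V β)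
  where
  open RealField ℝ
  open OrderedFieldProperties ℝ using (two)
  open Module V using (Carrierᴹ; _+ᴹ_; _*ₗ_)
  open IsSymmetricBilinear isSymmetricBilinear
  open import Algebra.Solver.Ring.NaturalCoefficients.Default commutativeSemiring
    using (solve; _:=_; con; _:+_; _:*_)
  open import Relation.Binary.Reasoning.Setoid setoid

  Hodge : Carrierᴹ → Set m
  Hodge h = ∀ x → β x h ≈ 0# → β x x ≤ 0#

  β-+ʳ : ∀ x y z → β x (y +ᴹ z) ≈ β x y + β x z
  β-+ʳ x y z = begin
    β x (y +ᴹ z)    ≈⟨ β-sym x (y +ᴹ z) ⟩
    β (y +ᴹ z) x    ≈⟨ β-+ˡ y z x ⟩
    β y x + β z x   ≈⟨ +-cong (β-sym y x) (β-sym z x) ⟩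
    β x y + β x z   ∎

  β-*ʳ : ∀ r x z → β x (r *ₗ z) ≈ r * β x z
  β-*ʳ r x z = begin
    β x (r *ₗ z)   ≈⟨ β-sym x (r *ₗ z) ⟩
    β (r *ₗ z) x   ≈⟨ β-*ˡ r z x ⟩
    r * β z x      ≈⟨ *-congˡ (β-sym z x) ⟩
    r * β x z      ∎

  β-*-* : ∀ r s x z → β (r *ₗ x) (s *ₗ z) ≈ r * (s * β x z)
  β-*-* r s x z = trans (β-*ˡ r x (s *ₗ z)) (*-congˡ (β-*ʳ s x z))

  β-square-+ : ∀ x y → β (x +ᴹ y) (x +ᴹ y) ≈ β x x + two * β x y + β y y
  β-square-+ x y = begin
    β (x +ᴹ y) (x +ᴹ y)                    ≈⟨ β-+ˡ x y (x +ᴹ y) ⟩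
    β x (x +ᴹ y) + β y (x +ᴹ y)            ≈⟨ +-cong (β-+ʳ x x y) (β-+ʳ y x y) ⟩
    (β x x + β x y) + (β y x + β y y)      ≈⟨ +-congˡ (+-congʳ (β-sym y x)) ⟩
    (β x x + β x y) + (β x y + β y y)      ≈⟨ solve 3 (λ a b c → (a :+ b) :+ (b :+ c) := a :+ con 2 :* b :+ c)
                                                      refl (β x x) (β x y) (β y y) ⟩
    β x x + two * β x y + β y y            ∎

module HyperbolicPair
  (ℝ : RealField) {m ℓm : Level} (V : Module (RealField.commRing ℝ) m ℓm)
  {β : Module.Carrierᴹ V → Module.Carrierᴹ V → RealField.Carrier ℝ}
  (isSymmetricBilinear : IsSymmetricBilinear ℝ V β)
  {e f : Module.Carrierᴹ V}
  (β-e-e : RealField._≈_ ℝ (β e e) (RealField.0# ℝ))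
  (β-f-f : RealField._≈_ ℝ (β f f) (RealField.0# ℝ))
  (β-e-f : RealField._≈_ ℝ (β e f) (RealField.1# ℝ))
  where
  open RealField ℝ
  open Module V using (Carrierᴹ; _+ᴹ_; _*ₗ_)
  open IsSymmetricBilinear isSymmetricBilinear
  open SymmetricBilinearProperties ℝ V isSymmetricBilinear
  open OrderedFieldProperties ℝ using (two; 2≰0; ≤-respˡ-≈; linear-solvable)
  open import Algebra.Solver.Ring.NaturalCoefficients.Default commutativeSemiring
    using (solve; _:=_; con; _:+_; _:*_)
  open import Relation.Binary.Reasoning.Setoid setoid

  β-hyperbolic : ∀ s t → β (s *ₗ e +ᴹ t *ₗ f) (s *ₗ e +ᴹ t *ₗ f) ≈ two * (s * t)
  β-hyperbolic s t = begin
    β (s *ₗ e +ᴹ t *ₗ f) (s *ₗ e +ᴹ t *ₗ f)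
      ≈⟨ β-square-+ (s *ₗ e) (t *ₗ f) ⟩
    β (s *ₗ e) (s *ₗ e) + two * β (s *ₗ e) (t *ₗ f) + β (t *ₗ f) (t *ₗ f)
      ≈⟨ +-cong (+-cong (β-*-* s s e e) (*-congˡ (β-*-* s t e f))) (β-*-* t t f f) ⟩
    s * (s * β e e) + two * (s * (t * β e f)) + t * (t * β f f)
      ≈⟨ +-cong (+-cong (*-congˡ (*-congˡ β-e-e)) (*-congˡ (*-congˡ (*-congˡ β-e-f)))) (*-congˡ (*-congˡ β-f-f)) ⟩
    s * (s * 0#) + two * (s * (t * 1#)) + t * (t * 0#)
      ≈⟨ solve 2 (λ s t → s :* (s :* con 0) :+ con 2 :* (s :* (t :* con 1)) :+ t :* (t :* con 0)
                        := con 2 :* (s :* t)) refl s t ⟩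
    two * (s * t)
      ∎

  β-translate : ∀ x s t →
    β (x +ᴹ (s *ₗ e +ᴹ t *ₗ f)) (x +ᴹ (s *ₗ e +ᴹ t *ₗ f)) + two * (β x e * β x f)
      ≈ β x x + two * ((s + β x f) * (t + β x e))
  β-translate x s t = begin
    β (x +ᴹ z) (x +ᴹ z) + two * (b * a)
      ≈⟨ +-congʳ (β-square-+ x z) ⟩
    β x x + two * β x z + β z z + two * (b * a)
      ≈⟨ +-congʳ (+-cong (+-congˡ (*-congˡ β-x-z)) (β-hyperbolic s t)) ⟩
    β x x + two * (s * b + t * a) + two * (s * t) + two * (b * a)
      ≈⟨ solve 5 (λ X s t a b → X :+ con 2 :* (s :* b :+ t :* a) :+ con 2 :* (s :* t) :+ con 2 :* (b :* a)
                              := X :+ con 2 :* ((s :+ a) :* (t :+ b))) refl (β x x) s t a b ⟩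
    β x x + two * ((s + a) * (t + b))
      ∎
    where
    z : Carrierᴹ
    z = s *ₗ e +ᴹ t *ₗ f
    a b : Carrier
    a = β x f
    b = β x e
    β-x-z : β x z ≈ s * b + t * a
    β-x-z = trans (β-+ʳ x (s *ₗ e) (t *ₗ f)) (+-cong (β-*ʳ s x e) (β-*ʳ t x f))

  β-e+f-e+f : β (e +ᴹ f) (e +ᴹ f) ≈ two
  β-e+f-e+f = begin
    β (e +ᴹ f) (e +ᴹ f)                 ≈⟨ β-square-+ e f ⟩
    β e e + two * β e f + β f f         ≈⟨ +-cong (+-cong β-e-e (*-congˡ β-e-f)) β-f-f ⟩
    0# + two * 1# + 0#                  ≈⟨ solve 0 (con 0 :+ con 2 :* con 1 :+ con 0 := con 2) refl ⟩
    two                                 ∎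

  hodge⇒β[e+f,h]≉0 : ∀ {h} → Hodge h → ¬ (β (e +ᴹ f) h ≈ 0#)
  hodge⇒β[e+f,h]≉0 hodge e+f⊥h = 2≰0 (≤-respˡ-≈ β-e+f-e+f (hodge (e +ᴹ f) e+f⊥h))

  β-translate-pairing : ∀ x h l →
    β (x +ᴹ ((l - β x f) *ₗ e +ᴹ (l - β x e) *ₗ f)) h
      ≈ l * β (e +ᴹ f) h + (β x h + (- β x f) * β e h + (- β x e) * β f h)
  β-translate-pairing x h l = begin
    β (x +ᴹ ((l - a) *ₗ e +ᴹ (l - b) *ₗ f)) h
      ≈⟨ trans (β-+ˡ x _ h) (+-congˡ (trans (β-+ˡ _ _ h) (+-cong (β-*ˡ (l - a) e h) (β-*ˡ (l - b) f h)))) ⟩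
    β x h + ((l - a) * P + (l - b) * R)
      -- l - a unfolds to l + - a, so - a and - b enter the semiring solver as atoms
      ≈⟨ solve 6 (λ l a′ b′ H P R → H :+ ((l :+ a′) :* P :+ (l :+ b′) :* R)
                                  := l :* (P :+ R) :+ (H :+ a′ :* P :+ b′ :* R)) refl l (- a) (- b) (β x h) P R ⟩
    l * (P + R) + (β x h + (- a) * P + (- b) * R)
      ≈⟨ +-congʳ (*-congˡ (β-+ˡ e f h)) ⟨
    l * β (e +ᴹ f) h + (β x h + (- a) * P + (- b) * R)
      ∎
    where
    a b P R : Carrier
    a = β x f
    b = β x e
    P = β e h
    R = β f h

  orthogonal-translate : ∀ {h} → ¬ (β (e +ᴹ f) h ≈ 0#) →
    ∀ x → ∃ λ l → β (x +ᴹ ((l - β x f) *ₗ e +ᴹ (l - β x e) *ₗ f)) h ≈ 0#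
  orthogonal-translate {h} β[e+f,h]≉0 x
    with linear-solvable β[e+f,h]≉0 (β x h + (- β x f) * β e h + (- β x e) * β f h)
  ... | l , lp+q≈0 = l , trans (β-translate-pairing x h l) lp+q≈0

lemma3p1 : (ℝ : RealField) {m ℓm : Level} (V : Module (RealField.commRing ℝ) m ℓm)
  (β : Module.Carrierᴹ V → Module.Carrierᴹ V → RealField.Carrier ℝ) →
  IsSymmetricBilinear ℝ V β →
  (v01 v10 ha : Module.Carrierᴹ V) →
  ¬ (Module._≈ᴹ_ V v01 (Module.0ᴹ V)) →
  ¬ (Module._≈ᴹ_ V v10 (Module.0ᴹ V)) →
  ¬ (Module._≈ᴹ_ V ha (Module.0ᴹ V)) →
  RealField._≈_ ℝ (β v01 v01) (RealField.0# ℝ) →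
  RealField._≈_ ℝ (β v10 v10) (RealField.0# ℝ) →
  RealField._≈_ ℝ (β v01 v10) (RealField.1# ℝ) →
  (∀ x → RealField._≈_ ℝ (β x ha) (RealField.0# ℝ) → RealField._≤_ ℝ (β x x) (RealField.0# ℝ)) →
  ∀ x → RealField._≤_ ℝ (β x x)
    (RealField._*_ ℝ (RealField._+_ ℝ (RealField.1# ℝ) (RealField.1# ℝ))
      (RealField._*_ ℝ (β x v01) (β x v10)))
lemma3p1 ℝ V β isSymmetricBilinear v01 v10 ha _ _ _ β-v01-v01 β-v10-v10 β-v01-v10 hodge x = begin
  β x x                                      ≤⟨ x≤x+y (0≤2*x*x l) ⟩
  β x x + two * (l * l)                      ≈⟨ +-congˡ (*-congˡ (*-cong (//-rightDividesˡ a l) (//-rightDividesˡ b l))) ⟨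
  β x x + two * ((l - a + a) * (l - b + b))  ≈⟨ β-translate x (l - a) (l - b) ⟨
  β y y + two * (b * a)                      ≤⟨ +-mono-≤ (β y y) 0# (two * (b * a)) (hodge y y⊥ha) ⟩
  0# + two * (b * a)                         ≈⟨ +-identityˡ (two * (b * a)) ⟩
  two * (b * a)                              ∎
  where
  open RealField ℝ
  open OrderedFieldProperties ℝ using (two; poset; x≤x+y; 0≤2*x*x)
  open HyperbolicPair ℝ V isSymmetricBilinear β-v01-v01 β-v10-v10 β-v01-v10
    using (β-translate; orthogonal-translate; hodge⇒β[e+f,h]≉0)
  open Module V using (Carrierᴹ; _+ᴹ_; _*ₗ_)
  open import Algebra.Properties.AbelianGroup +-abelianGroup using (//-rightDividesˡ)
  open import Relation.Binary.Reasoning.PartialOrder poset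
  a b l : Carrier
  a = β x v10
  b = β x v01
  l = proj₁ (orthogonal-translate (hodge⇒β[e+f,h]≉0 hodge) x)
  y : Carrierᴹ
  y = x +ᴹ ((l - a) *ₗ v01 +ᴹ (l - b) *ₗ v10)
  y⊥ha : β y ha ≈ 0#
  y⊥ha = proj₂ (orthogonal-translate (hodge⇒β[e+f,h]≉0 hodge) x)
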